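{- Let $P$ be a path on $n\ge 1$ vertices. Then $i(P)=\lceil n/3\rceil$. Moreover, if some minimum independent dominating set $I$ of $P$ contains two vertices whose distance in $P$ is congruent to $1$ modulo $3$, then $n\equiv 1\pmod 3$ and $I$ contains neither endpoint of $P$.
   Context: $i(G)$ is the minimum size of an independent dominating set of $G$, i.e. an independent set $A$ such that every vertex is in $A$ or adjacent to a vertex of $A$. -}

module Defs where

open import Data.Nat using (ℕ; zero; suc; _+_; _≤_; _/_; ∣_-_∣)
open import Data.Fin using (Fin; toℕ)
open import Data.Fin.Subset using (Subset; _∈_; ∣_∣)
open import Data.Product using (Σ; _×_; ∃)
open import Data.Sum using (_⊎_)
open import Relation.Nullary using (¬_)
open import Relation.Binary.PropositionalEquality using (_≡_)

Adj : {n : ℕ} → Fin n → Fin n → Set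
Adj i j = ∣ toℕ i - toℕ j ∣ ≡ 1

dist : {n : ℕ} → Fin n → Fin n → ℕ
dist i j = ∣ toℕ i - toℕ j ∣

Independent : (n : ℕ) → Subset n → Set
Independent n A = ∀ (i j : Fin n) → i ∈ A → j ∈ A → ¬ Adj i j

Dominating : (n : ℕ) → Subset n → Set
Dominating n A = ∀ (v : Fin n) → v ∈ A ⊎ Σ (Fin n) (λ u → u ∈ A × Adj u v)

IsIDS : (n : ℕ) → Subset n → Set
IsIDS n A = Independent n A × Dominating n A

IsMinIDS : (n : ℕ) → Subset n → Set
IsMinIDS n A = IsIDS n A × (∀ (B : Subset n) → IsIDS n B → ∣ A ∣ ≤ ∣ B ∣)

ceil3 : ℕ → ℕ
ceil3 n = (n + 2) / 3

-- Scan a subset of the path from left to right, remembering the status of the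
-- previous vertex: chosen, dominated, or not yet dominated.  Every chosen vertex
-- dominates three vertices, so 3|I| = n + slack, where the slack counts the
-- vertices dominated twice plus the chosen endpoints; hence |I| ≥ ⌈n/3⌉, and taking
-- every third vertex attains it.  Consecutive chosen vertices are 2 or 3 apart and
-- add 1 or 0 to the slack, so the slack accumulated up to a chosen vertex at distance
-- δ after another one is ≡ −δ (mod 3).  A pair at distance ≡ 1 thus forces slack ≥ 2,
-- whereas a minimum set has slack ≤ 2: so 3|I| = n + 2, and a chosen endpoint,
-- which would add one more, is impossible.

module Submission where

open import Defs
open import Data.Nat using (ℕ; suc; _%_; _≤_)
open import Data.Fin using (Fin; zero; fromℕ)
open import Data.Fin.Subset using (Subset; _∈_; _∉_; ∣_∣)
open import Data.Product using (Σ; _×_)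
open import Relation.Binary.PropositionalEquality using (_≡_)

open import Data.Nat using (zero; _+_; _*_; _<_; z≤n; s≤s)
open import Data.Nat.Properties
open import Data.Nat.DivMod using (m/n*n≤m; m<n*o⇒m/o<n; m/n≡1+[m∸n]/n; m*n%n≡0)
open import Data.Bool using (Bool; true; false)
open import Data.Fin using (suc; toℕ)
open import Data.Vec using ([]; _∷_; here; there)
open import Data.Product using (_,_; proj₁)
open import Data.Sum using (_⊎_; inj₁; inj₂)
open import Data.Empty using (⊥; ⊥-elim)
open import Data.Unit using (⊤; tt)
open import Relation.Nullary using (¬_)
open import Relation.Binary.PropositionalEquality using (refl; sym; trans; cong; subst)

ceil3[3+n]≡1+ceil3[n] : ∀ n → ceil3 (3 + n) ≡ suc (ceil3 n)
ceil3[3+n]≡1+ceil3[n] n = m/n≡1+[m∸n]/n {3 + n + 2} (s≤s (s≤s (s≤s z≤n)))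

ceil3*3≤n+2 : ∀ n → ceil3 n * 3 ≤ n + 2
ceil3*3≤n+2 n = m/n*n≤m (n + 2) 3

n≤k*3⇒ceil3≤k : ∀ {n k} → n ≤ k * 3 → ceil3 n ≤ k
n≤k*3⇒ceil3≤k {n} {k} n≤k*3 =
  ≤-pred (m<n*o⇒m/o<n (subst (_< suc k * 3) (+-comm 2 n) (+-monoʳ-≤ 3 n≤k*3)))

m%3≤1+[2+m]%3 : ∀ m → m % 3 ≤ suc ((2 + m) % 3)
m%3≤1+[2+m]%3 0 = z≤n
m%3≤1+[2+m]%3 1 = s≤s z≤n
m%3≤1+[2+m]%3 2 = s≤s (s≤s z≤n)
m%3≤1+[2+m]%3 (suc (suc (suc m))) = m%3≤1+[2+m]%3 m

m%3≡1⇒[m*2]%3≡2 : ∀ m → m % 3 ≡ 1 → (m * 2) % 3 ≡ 2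
m%3≡1⇒[m*2]%3≡2 1 _ = refl
m%3≡1⇒[m*2]%3≡2 (suc (suc (suc m))) eq = m%3≡1⇒[m*2]%3≡2 m eq

[m+2]%3≡0⇒m%3≡1 : ∀ m → (m + 2) % 3 ≡ 0 → m % 3 ≡ 1
[m+2]%3≡0⇒m%3≡1 1 _ = refl
[m+2]%3≡0⇒m%3≡1 (suc (suc (suc m))) eq = [m+2]%3≡0⇒m%3≡1 m eq

blocks : (n : ℕ) → Subset n
blocks 0 = []
blocks 1 = true ∷ []
blocks 2 = false ∷ true ∷ []
blocks (suc (suc (suc n))) = false ∷ true ∷ false ∷ blocks n

∣blocks∣≡ceil3 : ∀ n → ∣ blocks n ∣ ≡ ceil3 n
∣blocks∣≡ceil3 0 = refl
∣blocks∣≡ceil3 1 = refl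
∣blocks∣≡ceil3 2 = refl
∣blocks∣≡ceil3 (suc (suc (suc n))) =
  trans (cong suc (∣blocks∣≡ceil3 n)) (sym (ceil3[3+n]≡1+ceil3[n] n))

IsIDS-prepend-block : ∀ {n} {p : Subset n} → IsIDS n p → IsIDS (3 + n) (false ∷ true ∷ false ∷ p)
IsIDS-prepend-block {p = p} (ind , dom) = independent , dominating
  where
  independent : Independent _ (false ∷ true ∷ false ∷ p)
  independent _ _ (there here) (there (there (there _))) ()
  independent _ _ (there (there (there _))) (there here) ()
  independent _ _ (there (there (there i∈p))) (there (there (there j∈p))) = ind _ _ i∈p j∈p
  dominating : Dominating _ (false ∷ true ∷ false ∷ p)
  dominating zero = inj₂ (suc zero , there here , refl)
  dominating (suc zero) = inj₁ (there here)
  dominating (suc (suc zero)) = inj₂ (suc zero , there here , refl)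
  dominating (suc (suc (suc v))) with dom v
  ... | inj₁ v∈p = inj₁ (there (there (there v∈p)))
  ... | inj₂ (u , u∈p , adj) = inj₂ (suc (suc (suc u)) , there (there (there u∈p)) , adj)

blocks-IsIDS : ∀ n → IsIDS n (blocks n)
blocks-IsIDS 0 = (λ ()) , (λ ())
blocks-IsIDS 1 = (λ { _ _ here here () }) , (λ { zero → inj₁ here })
blocks-IsIDS 2 = (λ { _ _ (there here) (there here) () }) , λ
  { zero → inj₂ (suc zero , there here , refl)
  ; (suc zero) → inj₁ (there here)
  }
blocks-IsIDS (suc (suc (suc n))) = IsIDS-prepend-block (blocks-IsIDS n)

-- The status of the vertex preceding the current one; the path is read as if
-- preceded by a dominated, unchosen vertex.  Transitions excluded by Allowed
-- (a chosen vertex after a chosen one, an unchosen one after an undominated one)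
-- get junk targets.
data Status : Set where
  chosen dominated undominated : Status

step : Status → Bool → Status
step _ true = chosen
step chosen false = dominated
step _ false = undominated

Allowed : Status → Bool → Set
Allowed chosen true = ⊥
Allowed undominated false = ⊥
Allowed _ _ = ⊤

Accepting : Status → Set
Accepting undominated = ⊥
Accepting _ = ⊤

Valid : ∀ {n} → Status → Subset n → Set
Valid s [] = Accepting s
Valid s (b ∷ p) = Allowed s b × Valid (step s b) p

final : ∀ {n} → Status → Subset n → Status
final s [] = s
final s (b ∷ p) = final (step s b) p

-- Choosing a vertex after a dominated, unchosen one dominates that one twice
-- (or, at the start, wastes a domination on the virtual predecessor); a chosen
-- last vertex likewise wastes one.
penalty : Status → Bool → ℕ
penalty dominated true = 1
penalty _ _ = 0

endPenalty : Status → ℕ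
endPenalty chosen = 1
endPenalty _ = 0

slack : ∀ {n} → Status → Subset n → ℕ
slack s [] = endPenalty s
slack s (b ∷ p) = penalty s b + slack (step s b) p

endPenalty≤slack : ∀ {n} s (p : Subset n) → endPenalty (final s p) ≤ slack s p
endPenalty≤slack s [] = ≤-refl
endPenalty≤slack s (b ∷ p) = ≤-trans (endPenalty≤slack (step s b) p) (m≤n+m _ (penalty s b))

potential : Status → ℕ
potential chosen = 2
potential dominated = 1
potential undominated = 0

potential+∣p∣*3≡1+n+slack : ∀ {n} s (p : Subset n) → Valid s p →
  potential s + ∣ p ∣ * 3 ≡ suc (n + slack s p)
potential+∣p∣*3≡1+n+slack chosen [] _ = refl
potential+∣p∣*3≡1+n+slack dominated [] _ = refl
potential+∣p∣*3≡1+n+slack chosen (false ∷ p) (_ , v) =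
  cong suc (potential+∣p∣*3≡1+n+slack dominated p v)
potential+∣p∣*3≡1+n+slack {suc n} dominated (true ∷ p) (_ , v) =
  trans (cong (2 +_) (potential+∣p∣*3≡1+n+slack chosen p v))
        (cong (λ k → suc (suc k)) (sym (+-suc n (slack chosen p))))
potential+∣p∣*3≡1+n+slack dominated (false ∷ p) (_ , v) =
  cong suc (potential+∣p∣*3≡1+n+slack undominated p v)
potential+∣p∣*3≡1+n+slack undominated (true ∷ p) (_ , v) =
  cong suc (potential+∣p∣*3≡1+n+slack chosen p v)

∣p∣*3≡n+slack : ∀ {n} (p : Subset n) → Valid dominated p → ∣ p ∣ * 3 ≡ n + slack dominated p
∣p∣*3≡n+slack p v = suc-injective (potential+∣p∣*3≡1+n+slack dominated p v)

DominatedBy : ∀ {n} → Subset n → Fin n → Set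
DominatedBy p v = v ∈ p ⊎ Σ (Fin _) (λ u → u ∈ p × Adj u v)

DominatedAfter : ∀ {n} → Status → Subset n → Fin n → Set
DominatedAfter s p v = DominatedBy p v ⊎ (s ≡ chosen × toℕ v ≡ 0)

Opens : ∀ {n} → Status → Subset n → Set
Opens s [] = Accepting s
Opens s (b ∷ _) = Allowed s b

independent-tail : ∀ {n b} {p : Subset n} → Independent (suc n) (b ∷ p) → Independent n p
independent-tail ind i j i∈p j∈p = ind (suc i) (suc j) (there i∈p) (there j∈p)

dominatedAfter-tail : ∀ {n s b} {p : Subset n} →
  (∀ v → DominatedAfter s (b ∷ p) v) → ∀ v → DominatedAfter (step s b) p v
dominatedAfter-tail dom v with dom (suc v)
... | inj₁ (inj₁ (there v∈p)) = inj₁ (inj₁ v∈p)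
... | inj₁ (inj₂ (zero , here , adj)) = inj₂ (refl , suc-injective adj)
... | inj₁ (inj₂ (suc u , there u∈p , adj)) = inj₁ (inj₂ (u , u∈p , adj))

opens-step : ∀ {n} s b (p : Subset n) → Independent (suc n) (b ∷ p) →
  (∀ v → DominatedAfter s (b ∷ p) v) → Allowed s b → Opens (step s b) p
opens-step _ true [] _ _ _ = tt
opens-step _ true (false ∷ _) _ _ _ = tt
opens-step _ true (true ∷ _) ind _ _ = ⊥-elim (ind zero (suc zero) here (there here) refl)
opens-step chosen false [] _ _ _ = tt
opens-step chosen false (_ ∷ _) _ _ _ = tt
-- An unchosen first vertex after an unchosen predecessor is dominated only by the second.
opens-step dominated false p _ dom _ with dom zero
... | inj₁ (inj₂ (suc zero , there here , _)) = tt

IsIDS-after⇒Valid : ∀ {n} s (p : Subset n) →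
  Independent n p → (∀ v → DominatedAfter s p v) → Opens s p → Valid s p
IsIDS-after⇒Valid s [] _ _ opens = opens
IsIDS-after⇒Valid s (b ∷ p) ind dom opens =
  opens , IsIDS-after⇒Valid (step s b) p
            (independent-tail ind) (dominatedAfter-tail dom) (opens-step s b p ind dom opens)

IsIDS⇒Valid : ∀ {n} (p : Subset n) → IsIDS n p → Valid dominated p
IsIDS⇒Valid p (ind , dom) =
  IsIDS-after⇒Valid dominated p ind (λ v → inj₁ (dom v)) (opens-dominated p)
  where
  opens-dominated : ∀ {n} (q : Subset n) → Opens dominated q
  opens-dominated [] = tt
  opens-dominated (_ ∷ _) = tt

ceil3≤∣p∣ : ∀ {n} {p : Subset n} → IsIDS n p → ceil3 n ≤ ∣ p ∣
ceil3≤∣p∣ {n} {p} ids =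
  n≤k*3⇒ceil3≤k (subst (n ≤_) (sym (∣p∣*3≡n+slack p (IsIDS⇒Valid p ids)))
                       (m≤m+n n (slack dominated p)))

IsMinIDS⇒slack≤2 : ∀ {n} {p : Subset n} → IsMinIDS n p → slack dominated p ≤ 2
IsMinIDS⇒slack≤2 {n} {p} (ids , minimum) = +-cancelˡ-≤ n _ _ (begin
  n + slack dominated p  ≡⟨ sym (∣p∣*3≡n+slack p (IsIDS⇒Valid p ids)) ⟩
  ∣ p ∣ * 3              ≤⟨ *-monoˡ-≤ 3 ∣p∣≤ceil3 ⟩
  ceil3 n * 3            ≤⟨ ceil3*3≤n+2 n ⟩
  n + 2                  ∎)
  where
  open ≤-Reasoning
  ∣p∣≤ceil3 = subst (∣ p ∣ ≤_) (∣blocks∣≡ceil3 n) (minimum (blocks n) (blocks-IsIDS n))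

-- The residue mod 3 of the slack accumulated between a predecessor of status s
-- and a chosen vertex δ steps later (δ * 2 ≡ −δ); it is forced by the counting
-- identity applied to that stretch.
phase : Status → ℕ → ℕ
phase s δ = (suc (potential s) + δ * 2) % 3

phase-step : ∀ s b δ → Allowed s b →
  phase s (suc (suc δ)) ≤ penalty s b + phase (step s b) (suc δ)
phase-step chosen false δ _ = ≤-refl
phase-step dominated true δ _ = m%3≤1+[2+m]%3 (δ * 2)
phase-step dominated false δ _ = ≤-refl
phase-step undominated true δ _ = ≤-refl

phase+endPenalty≤slack : ∀ {n} s (p : Subset n) {v} → Valid s p → v ∈ p →
  phase s (suc (toℕ v)) + endPenalty (final s p) ≤ slack s p
phase+endPenalty≤slack dominated (true ∷ p) _ here = s≤s (endPenalty≤slack chosen p)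
phase+endPenalty≤slack undominated (true ∷ p) _ here = endPenalty≤slack chosen p
phase+endPenalty≤slack s (b ∷ p) {suc v} (allowed , valid) (there v∈p) = begin
  phase s (2 + toℕ v) + e                             ≤⟨ +-monoˡ-≤ e (phase-step s b (toℕ v) allowed) ⟩
  penalty s b + phase (step s b) (suc (toℕ v)) + e    ≡⟨ +-assoc (penalty s b) _ e ⟩
  penalty s b + (phase (step s b) (suc (toℕ v)) + e)  ≤⟨ +-monoʳ-≤ (penalty s b) tail-bound ⟩
  slack s (b ∷ p)                                     ∎
  where
  open ≤-Reasoning
  e = endPenalty (final s (b ∷ p))
  tail-bound = phase+endPenalty≤slack (step s b) p valid v∈p

2+endPenalty≤slack-after-chosen : ∀ {n} (p : Subset n) {v} →
  Valid chosen p → v ∈ p → suc (toℕ v) % 3 ≡ 1 →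
  2 + endPenalty (final chosen p) ≤ slack chosen p
2+endPenalty≤slack-after-chosen p {v} valid v∈p δ≡1 =
  subst (λ r → r + endPenalty (final chosen p) ≤ slack chosen p)
        (m%3≡1⇒[m*2]%3≡2 (suc (toℕ v)) δ≡1)
        (phase+endPenalty≤slack chosen p valid v∈p)

2+endPenalty≤slack : ∀ {n} s (p : Subset n) {u v} →
  Valid s p → u ∈ p → v ∈ p → dist u v % 3 ≡ 1 →
  2 + endPenalty (final s p) ≤ slack s p
2+endPenalty≤slack s (true ∷ p) (_ , valid) here (there v∈p) d≡1 =
  ≤-trans (2+endPenalty≤slack-after-chosen p valid v∈p d≡1) (m≤n+m _ (penalty s true))
2+endPenalty≤slack s (true ∷ p) (_ , valid) (there u∈p) here d≡1 =
  ≤-trans (2+endPenalty≤slack-after-chosen p valid u∈p d≡1) (m≤n+m _ (penalty s true))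
2+endPenalty≤slack s (b ∷ p) (_ , valid) (there u∈p) (there v∈p) d≡1 =
  ≤-trans (2+endPenalty≤slack (step s b) p valid u∈p v∈p d≡1) (m≤n+m _ (penalty s b))

3+endPenalty≤slack : ∀ {n} (p : Subset (suc n)) {u v} →
  Valid dominated p → zero ∈ p → u ∈ p → v ∈ p → dist u v % 3 ≡ 1 →
  3 + endPenalty (final dominated p) ≤ slack dominated p
3+endPenalty≤slack (true ∷ p) (_ , valid) here here (there v∈p) d≡1 =
  s≤s (2+endPenalty≤slack-after-chosen p valid v∈p d≡1)
3+endPenalty≤slack (true ∷ p) (_ , valid) here (there u∈p) here d≡1 =
  s≤s (2+endPenalty≤slack-after-chosen p valid u∈p d≡1)
3+endPenalty≤slack (true ∷ p) (_ , valid) here (there u∈p) (there v∈p) d≡1 =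
  s≤s (2+endPenalty≤slack chosen p valid u∈p v∈p d≡1)

final≡chosen : ∀ {m} s (p : Subset (suc m)) → fromℕ m ∈ p → final s p ≡ chosen
final≡chosen {zero} s (true ∷ []) here = refl
final≡chosen {suc m} s (b ∷ p) (there last∈p) = final≡chosen (step s b) p last∈p

blocks-IsMinIDS : ∀ n → IsMinIDS n (blocks n)
blocks-IsMinIDS n =
  blocks-IsIDS n , λ B ids → subst (_≤ ∣ B ∣) (sym (∣blocks∣≡ceil3 n)) (ceil3≤∣p∣ ids)

IsMinIDS-rigid : ∀ m (I : Subset (suc m)) {u v} →
  IsMinIDS (suc m) I → u ∈ I → v ∈ I → dist u v % 3 ≡ 1 →
  (suc m % 3 ≡ 1) × (zero ∉ I) × (fromℕ m ∉ I)
IsMinIDS-rigid m I isMin u∈I v∈I d≡1 = n%3≡1 , first∉I , last∉I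
  where
  n = suc m
  valid = IsIDS⇒Valid I (proj₁ isMin)
  slack≤2 = IsMinIDS⇒slack≤2 isMin
  2+e≤slack = 2+endPenalty≤slack dominated I valid u∈I v∈I d≡1
  ¬3≤2 : ¬ 3 ≤ 2
  ¬3≤2 (s≤s (s≤s ()))
  slack≡2 : slack dominated I ≡ 2
  slack≡2 = ≤-antisym slack≤2 (≤-trans (m≤m+n 2 _) 2+e≤slack)
  n%3≡1 : n % 3 ≡ 1
  n%3≡1 = [m+2]%3≡0⇒m%3≡1 n (subst (λ k → k % 3 ≡ 0)
    (trans (∣p∣*3≡n+slack I valid) (cong (n +_) slack≡2)) (m*n%n≡0 ∣ I ∣ 3))
  first∉I : zero ∉ I
  first∉I first∈I = ¬3≤2 (≤-trans (m≤m+n 3 _)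
    (≤-trans (3+endPenalty≤slack I valid first∈I u∈I v∈I d≡1) slack≤2))
  last∉I : fromℕ m ∉ I
  last∉I last∈I = ¬3≤2 (≤-trans (subst (λ e → 2 + endPenalty e ≤ slack dominated I)
    (final≡chosen dominated I last∈I) 2+e≤slack) slack≤2)

lemma3p3 : (m : ℕ) →
  (Σ (Subset (suc m)) (λ A → IsMinIDS (suc m) A × ∣ A ∣ ≡ ceil3 (suc m)))
  × (∀ (I : Subset (suc m)) → IsMinIDS (suc m) I →
       ∀ (u v : Fin (suc m)) → u ∈ I → v ∈ I → dist u v % 3 ≡ 1 →
       (suc m % 3 ≡ 1) × (zero ∉ I) × (fromℕ m ∉ I))
lemma3p3 m =
  (blocks (suc m) , blocks-IsMinIDS (suc m) , ∣blocks∣≡ceil3 (suc m)) ,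
  λ I isMin _ _ → IsMinIDS-rigid m I isMin
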